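{- Let $2\le m\le n^{1/3}$ and set $s=\sqrt{n/m}$. Let $\mathcal P=\{(a,0): a\in\mathbb Z,\ 1\le a\le m\}$ and $\mathcal Q=\{(i,\sqrt j): i,j\in\mathbb Z,\ 1\le i\le s,\ s^2+1-i^2\le j\le s^2+ms-i^2\}$. Then $D(\mathcal P,\mathcal Q)=\Theta(\sqrt{mn})$, i.e. there are absolute constants $0<c\le C$ with $c\sqrt{mn}\le D(\mathcal P,\mathcal Q)\le C\sqrt{mn}$.
   Context: For finite sets $\mathcal P,\mathcal Q\subset\mathbb R^2$, $D(\mathcal P,\mathcal Q)=|\{d(p,q): p\in\mathcal P,\ q\in\mathcal Q\}|$ is the number of distinct Euclidean distances between a point of $\mathcal P$ and a point of $\mathcal Q$. -}

module Defs where

open import Data.Nat using (ℕ; suc; _+_; _*_; _∸_; _^_; _≤_; ∣_-_∣)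
open import Data.Nat.Properties using (_≟_; _≤?_)
open import Data.List using (List; map; filter; upTo; cartesianProduct; concatMap; deduplicate; length)
open import Data.Product using (_×_; _,_)
open import Relation.Nullary.Decidable using (_×-dec_)
open import Relation.Unary using (Decidable)

-- P = {(a,0) : 1 ≤ a ≤ m}, encoded by a.
-- Q = {(i, sqrt j)}, encoded by the pair (i , j).
-- Membership conditions of Q, cleared of square roots (all exact):
--   1 ≤ i                       (i ≥ 1)
--   m * i² ≤ n                  (i ≤ s  ⇔  i² ≤ n/m)
--   n + m ≤ m * (j + i²)        (s² + 1 − i² ≤ j)
--   (m (j + i²) ∸ n)² ≤ m³ n    (j ≤ s² + m s − i²  ⇔  m(j+i²) − n ≤ sqrt(m³ n))
InQ : ℕ → ℕ → ℕ × ℕ → Set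
InQ m n (i , j) =
  (1 ≤ i × m * (i * i) ≤ n) ×
  (n + m ≤ m * (j + i * i) × (m * (j + i * i) ∸ n) ^ 2 ≤ m ^ 3 * n)

inQ? : ∀ m n → Decidable (InQ m n)
inQ? m n (i , j) =
  ((1 ≤? i) ×-dec (m * (i * i) ≤? n)) ×-dec
  ((n + m ≤? m * (j + i * i)) ×-dec ((m * (j + i * i) ∸ n) ^ 2 ≤? m ^ 3 * n))

-- The point set Q as an explicit list.  Every point of Q has i ≤ n and
-- j ≤ n + m * n (since j ≤ n/m + sqrt(m n)), so enumerating those ranges
-- and filtering by InQ gives exactly Q.
Qpts : ℕ → ℕ → List (ℕ × ℕ)
Qpts m n = filter (inQ? m n) (cartesianProduct (upTo (suc n)) (upTo (suc (n + m * n))))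

Ppts : ℕ → List ℕ
Ppts m = map suc (upTo m)

-- Squared Euclidean distance between (a,0) and (i, sqrt j): (a − i)² + j.
sqDist : ℕ → ℕ × ℕ → ℕ
sqDist a (i , j) = ∣ a - i ∣ ^ 2 + j

-- Distinct squared distances (distances are ≥ 0, so distinct distances
-- correspond exactly to distinct squared distances).
distinctSqDists : ℕ → ℕ → List ℕ
distinctSqDists m n = deduplicate _≟_ (concatMap (λ a → map (sqDist a) (Qpts m n)) (Ppts m))

D : ℕ → ℕ → ℕ
D m n = length (distinctSqDists m n)

-- Write d = (a − i)² + j for the squared distance from (a, 0) to (i, √j), and
-- r = ⌊√(mn)⌋, so that m² ≤ r because m³ ≤ n.  The conditions defining Q say
-- that m(i² + j) lies between n + m and n + √(m³n) < n + m(r + 1), and they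
-- force m·i ≤ r.  As d + 2ai = a² + i² + j with a ≤ m, the quantity m·d lies in
-- a window of width m(m² + 3r) around n, so there are at most 1 + m² + 3r ≤ 5r
-- distinct squared distances.  Conversely, for n/m < j < n/m + r the points
-- (1, √j) lie in Q and realise the r − 1 distinct squared distances j.  Both
-- counts are Θ(√(mn)).
module Submission where

open import Defs

open import Data.Nat
open import Data.Nat.Properties
open import Data.Nat.Tactic.RingSolver using (solve-∀)
open import Data.Product using (∃; ∃₂; _×_; _,_; proj₂)
open import Data.List using (List; []; _∷_; length; map; upTo; cartesianProduct; concatMap)
open import Data.List.Properties using (length-map; length-upTo; length-removeAt′)
open import Data.List.Relation.Unary.Any using (here; there; index; _─_)
open import Data.List.Relation.Unary.All using (All; _∷_; tabulate; lookup)
open import Data.List.Relation.Unary.AllPairs using ([]; _∷_)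
open import Data.List.Relation.Unary.Unique.Propositional using (Unique)
open import Data.List.Relation.Unary.Unique.Propositional.Properties using (map⁺; upTo⁺)
open import Data.Nat.DivMod using (_/_; _%_; m/n*n≤m; m/n≤m; m%n<n; m≡m%n+[m/n]*n)
open import Data.List.Relation.Unary.Unique.DecPropositional.Properties _≟_ using (deduplicate-!)
open import Data.List.Relation.Binary.Subset.Propositional using (_⊆_)
open import Data.List.Membership.Propositional using (_∈_; find; lose)
open import Data.List.Membership.Propositional.Properties
  using (∈-map⁺; ∈-map⁻; ∈-upTo⁺; ∈-upTo⁻; ∈-filter⁺; ∈-filter⁻; ∈-cartesianProduct⁺;
         ∈-concatMap⁺; ∈-concatMap⁻; ∈-deduplicate⁺; ∈-deduplicate⁻)
open import Data.List.Extrema.Nat using (min; min≤⊤; min≤xs; argmin-all)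
open import Function using (id)
open import Relation.Binary.PropositionalEquality
open import Relation.Nullary using (contradiction; yes; no)

private variable A : Set

∈-─ : ∀ {x y : A} {ys} (x∈ys : x ∈ ys) → y ∈ ys → y ≢ x → y ∈ (ys ─ x∈ys)
∈-─ (here refl) (here refl) y≢x = contradiction refl y≢x
∈-─ (here refl) (there y∈ys) _  = y∈ys
∈-─ (there _)   (here refl) _   = here refl
∈-─ (there x∈ys) (there y∈ys) y≢x = there (∈-─ x∈ys y∈ys y≢x)

Unique-⊆⇒length≤ : ∀ {xs ys : List A} → Unique xs → xs ⊆ ys → length xs ≤ length ys
Unique-⊆⇒length≤ [] _ = z≤n
Unique-⊆⇒length≤ {xs = x ∷ xs} {ys} (x∉xs ∷ xs!) xs⊆ys = begin
  suc (length xs)          ≤⟨ s≤s (Unique-⊆⇒length≤ xs! xs⊆ys─x) ⟩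
  suc (length (ys ─ x∈ys)) ≡⟨ length-removeAt′ ys (index x∈ys) ⟨
  length ys                ∎
  where
  open ≤-Reasoning
  x∈ys = xs⊆ys (here refl)
  xs⊆ys─x : xs ⊆ (ys ─ x∈ys)
  xs⊆ys─x y∈xs = ∈-─ x∈ys (xs⊆ys (there y∈xs)) (≢-sym (lookup x∉xs y∈xs))

Unique⇒length≤1+spread : ∀ (xs : List ℕ) W → Unique xs →
  (∀ {v w} → v ∈ xs → w ∈ xs → v ≤ w + W) → length xs ≤ suc W
Unique⇒length≤1+spread [] W _ _ = z≤n
Unique⇒length≤1+spread xs@(x ∷ xs′) W xs! spread = begin
  length xs       ≤⟨ Unique-⊆⇒length≤ xs! xs⊆window ⟩
  length window   ≡⟨ trans (length-map (μ +_) (upTo (suc W))) (length-upTo (suc W)) ⟩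
  suc W           ∎
  where
  open ≤-Reasoning
  μ = min x xs′
  window = map (μ +_) (upTo (suc W))
  μ≤ : All (μ ≤_) xs
  μ≤ = min≤⊤ x xs′ ∷ min≤xs x xs′
  ≤μ+W : ∀ {v} → v ∈ xs → v ≤ μ + W
  ≤μ+W v∈xs = argmin-all id {P = λ w → _ ≤ w + W}
    (spread v∈xs (here refl)) (tabulate (λ w∈xs′ → spread v∈xs (there w∈xs′)))
  xs⊆window : xs ⊆ window
  xs⊆window {v} v∈xs = subst (_∈ window) (m+[n∸m]≡n (lookup μ≤ v∈xs))
    (∈-map⁺ (μ +_) (∈-upTo⁺ (s≤s (subst (v ∸ μ ≤_) (m+n∸m≡n μ W) (∸-monoˡ-≤ μ (≤μ+W v∈xs))))))

m*m<n*n⇒m<n : ∀ {m n} → m * m < n * n → m < n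
m*m<n*n⇒m<n m*m<n*n = ≰⇒> (λ n≤m → <⇒≱ m*m<n*n (*-mono-≤ n≤m n≤m))

⌊√⌋ : ∀ N → ∃ λ r → r * r ≤ N × N < suc r * suc r
⌊√⌋ zero = 0 , z≤n , s≤s z≤n
⌊√⌋ (suc N) with ⌊√⌋ N
... | r , r²≤N , N<[1+r]² with suc N <? suc r * suc r
...   | yes 1+N<[1+r]² = r , m≤n⇒m≤1+n r²≤N , 1+N<[1+r]²
...   | no  1+N≮[1+r]² = suc r , ≮⇒≥ 1+N≮[1+r]² , ≤-<-trans N<[1+r]² (*-mono-< (n<1+n (suc r)) (n<1+n (suc r)))

m^2≡m*m : ∀ m → m ^ 2 ≡ m * m
m^2≡m*m m = cong (m *_) (*-identityʳ m)

m^3≡m*[m*m] : ∀ m → m ^ 3 ≡ m * (m * m)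
m^3≡m*[m*m] m = cong (λ x → m * (m * x)) (*-identityʳ m)

m³≤n⇒m*m≤r : ∀ {m n r} → m ^ 3 ≤ n → m * n < suc r * suc r → m * m ≤ r
m³≤n⇒m*m≤r {m} {n} {r} m³≤n mn<[1+r]² = m<1+n⇒m≤n (m*m<n*n⇒m<n (begin-strict
  (m * m) * (m * m) ≡⟨ regroup m ⟩
  m * (m * (m * m)) ≡⟨ cong (m *_) (m^3≡m*[m*m] m) ⟨
  m * m ^ 3         ≤⟨ *-monoʳ-≤ m m³≤n ⟩
  m * n             <⟨ mn<[1+r]² ⟩
  suc r * suc r     ∎))
  where
  open ≤-Reasoning
  regroup : ∀ a → (a * a) * (a * a) ≡ a * (a * (a * a))
  regroup = solve-∀

∣m-n∣²+2mn≡m²+n² : ∀ m n → ∣ m - n ∣ * ∣ m - n ∣ + 2 * (m * n) ≡ m * m + n * n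
∣m-n∣²+2mn≡m²+n² zero    n       = +-identityʳ (n * n)
∣m-n∣²+2mn≡m²+n² (suc m) zero    = cong (λ x → suc m * suc m + 2 * x) (*-zeroʳ (suc m))
∣m-n∣²+2mn≡m²+n² (suc m) (suc n) = begin
  d * d + 2 * (suc m * suc n)               ≡⟨ shift (d * d) m n ⟩
  d * d + 2 * (m * n) + 2 * (1 + m + n)     ≡⟨ cong (_+ 2 * (1 + m + n)) (∣m-n∣²+2mn≡m²+n² m n) ⟩
  m * m + n * n + 2 * (1 + m + n)           ≡⟨ expand m n ⟩
  suc m * suc m + suc n * suc n             ∎
  where
  open ≡-Reasoning
  d = ∣ m - n ∣
  shift : ∀ x a b → x + 2 * ((1 + a) * (1 + b)) ≡ x + 2 * (a * b) + 2 * (1 + a + b)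
  shift = solve-∀
  expand : ∀ a b → a * a + b * b + 2 * (1 + a + b) ≡ (1 + a) * (1 + a) + (1 + b) * (1 + b)
  expand = solve-∀

sqDist+2ai≡a²+j+i² : ∀ a i j → sqDist a (i , j) + 2 * (a * i) ≡ a * a + (j + i * i)
sqDist+2ai≡a²+j+i² a i j = begin
  d ^ 2 + j + 2 * (a * i)       ≡⟨ cong (λ x → x + j + 2 * (a * i)) (m^2≡m*m d) ⟩
  d * d + j + 2 * (a * i)       ≡⟨ swap (d * d) j (2 * (a * i)) ⟩
  d * d + 2 * (a * i) + j       ≡⟨ cong (_+ j) (∣m-n∣²+2mn≡m²+n² a i) ⟩
  a * a + i * i + j             ≡⟨ +-assoc (a * a) (i * i) j ⟩
  a * a + (i * i + j)           ≡⟨ cong (a * a +_) (+-comm (i * i) j) ⟩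
  a * a + (j + i * i)           ∎
  where
  open ≡-Reasoning
  d = ∣ a - i ∣
  swap : ∀ x y z → x + y + z ≡ x + z + y
  swap = solve-∀

∈-distinctSqDists⁻ : ∀ {m n v} → v ∈ distinctSqDists m n →
  ∃₂ λ a q → a ≤ m × InQ m n q × v ≡ sqDist a q
∈-distinctSqDists⁻ {m} {n} v∈D
  with a , a∈P , v∈Da ← find (∈-concatMap⁻ _ {xs = Ppts m} (∈-deduplicate⁻ _≟_ _ v∈D))
  with k , k∈upTo , refl ← ∈-map⁻ suc a∈P
  with q , q∈Q , refl ← ∈-map⁻ (sqDist a) v∈Da
  = a , q , ∈-upTo⁻ k∈upTo , proj₂ (∈-filter⁻ (inQ? m n) {xs = candidates} q∈Q) , refl
  where candidates = cartesianProduct (upTo (suc n)) (upTo (suc (n + m * n)))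

∈-distinctSqDists⁺ : ∀ {m n a i j} → 1 ≤ a → a ≤ m → i ≤ n → j ≤ n + m * n →
  InQ m n (i , j) → sqDist a (i , j) ∈ distinctSqDists m n
∈-distinctSqDists⁺ {m} {n} {suc k} _ a≤m i≤n j≤n+mn q∈Q =
  ∈-deduplicate⁺ _≟_ (∈-concatMap⁺ _ {xs = Ppts m} (lose (∈-map⁺ suc (∈-upTo⁺ a≤m))
    (∈-map⁺ _ (∈-filter⁺ (inQ? m n) (∈-cartesianProduct⁺ (∈-upTo⁺ (s≤s i≤n)) (∈-upTo⁺ (s≤s j≤n+mn))) q∈Q))))

module _ {m n r : ℕ} .{{_ : NonZero m}} (mn<[1+r]² : m * n < suc r * suc r) where

  InQ⇒m*i≤r : ∀ {i j} → InQ m n (i , j) → m * i ≤ r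
  InQ⇒m*i≤r {i} ((_ , mi²≤n) , _) = m<1+n⇒m≤n (m*m<n*n⇒m<n (begin-strict
    (m * i) * (m * i) ≡⟨ rearrange m i ⟩
    m * (m * (i * i)) ≤⟨ *-monoʳ-≤ m mi²≤n ⟩
    m * n             <⟨ mn<[1+r]² ⟩
    suc r * suc r     ∎))
    where
    open ≤-Reasoning
    rearrange : ∀ a b → (a * b) * (a * b) ≡ a * (a * (b * b))
    rearrange = solve-∀

  InQ⇒m[j+i²]<n+m[1+r] : ∀ {i j} → InQ m n (i , j) → m * (j + i * i) < n + m * suc r
  InQ⇒m[j+i²]<n+m[1+r] {i} {j} (_ , (_ , excess²≤m³n)) = begin-strict
    m * (j + i * i) ≤⟨ m≤n+m∸n _ n ⟩
    n + excess      <⟨ +-monoʳ-< n excess<m[1+r] ⟩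
    n + m * suc r   ∎
    where
    open ≤-Reasoning
    excess = m * (j + i * i) ∸ n
    regroup : ∀ a b → a * (a * a) * b ≡ (a * a) * (a * b)
    regroup = solve-∀
    square-product : ∀ a b → (a * a) * (b * b) ≡ (a * b) * (a * b)
    square-product = solve-∀
    excess<m[1+r] : excess < m * suc r
    excess<m[1+r] = m*m<n*n⇒m<n (begin-strict
      excess * excess           ≡⟨ m^2≡m*m excess ⟨
      excess ^ 2                ≤⟨ excess²≤m³n ⟩
      m ^ 3 * n                 ≡⟨ cong (_* n) (m^3≡m*[m*m] m) ⟩
      m * (m * m) * n           ≡⟨ regroup m n ⟩
      (m * m) * (m * n)         <⟨ *-monoʳ-< (m * m) {{m*n≢0 m m}} mn<[1+r]² ⟩
      (m * m) * (suc r * suc r) ≡⟨ square-product m (suc r) ⟩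
      (m * suc r) * (m * suc r) ∎)

  sqDist-upper : ∀ {a i j} → a ≤ m → InQ m n (i , j) →
    m * sqDist a (i , j) < n + m * (m * m + suc r)
  sqDist-upper {a} {i} {j} a≤m q∈Q = begin-strict
    m * d                               ≤⟨ *-monoʳ-≤ m (m≤m+n d (2 * (a * i))) ⟩
    m * (d + 2 * (a * i))               ≡⟨ cong (m *_) (sqDist+2ai≡a²+j+i² a i j) ⟩
    m * (a * a + (j + i * i))           ≡⟨ *-distribˡ-+ m (a * a) (j + i * i) ⟩
    m * (a * a) + m * (j + i * i)       <⟨ +-mono-≤-< (*-monoʳ-≤ m (*-mono-≤ a≤m a≤m)) (InQ⇒m[j+i²]<n+m[1+r] q∈Q) ⟩
    m * (m * m) + (n + m * suc r)       ≡⟨ regroup m n (m * m) (suc r) ⟩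
    n + m * (m * m + suc r)             ∎
    where
    open ≤-Reasoning
    d = sqDist a (i , j)
    regroup : ∀ a b x y → a * x + (b + a * y) ≡ b + a * (x + y)
    regroup = solve-∀

  sqDist-lower : ∀ {a i j} → a ≤ m → InQ m n (i , j) →
    n + m ≤ m * sqDist a (i , j) + m * (2 * r)
  sqDist-lower {a} {i} {j} a≤m q∈Q@(_ , (n+m≤m[j+i²] , _)) = begin
    n + m                       ≤⟨ n+m≤m[j+i²] ⟩
    m * (j + i * i)             ≤⟨ *-monoʳ-≤ m (m≤n+m (j + i * i) (a * a)) ⟩
    m * (a * a + (j + i * i))   ≡⟨ cong (m *_) (sqDist+2ai≡a²+j+i² a i j) ⟨
    m * (d + 2 * (a * i))       ≡⟨ *-distribˡ-+ m d (2 * (a * i)) ⟩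
    m * d + m * (2 * (a * i))   ≤⟨ +-monoʳ-≤ (m * d) (*-monoʳ-≤ m (*-monoʳ-≤ 2 ai≤r)) ⟩
    m * d + m * (2 * r)         ∎
    where
    open ≤-Reasoning
    d = sqDist a (i , j)
    ai≤r : a * i ≤ r
    ai≤r = ≤-trans (*-monoˡ-≤ i a≤m) (InQ⇒m*i≤r q∈Q)

  sqDist-spread : ∀ {a i j b k l} → a ≤ m → InQ m n (i , j) → b ≤ m → InQ m n (k , l) →
    sqDist a (i , j) ≤ sqDist b (k , l) + (m * m + 3 * r)
  sqDist-spread {a} {i} {j} {b} {k} {l} a≤m p∈Q b≤m q∈Q = m<1+n⇒m≤n (*-cancelˡ-< m _ _ (begin-strict
    m * d                                     <⟨ sqDist-upper a≤m p∈Q ⟩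
    n + m * (m * m + suc r)                   ≤⟨ +-monoˡ-≤ _ (≤-trans (m≤m+n n m) (sqDist-lower b≤m q∈Q)) ⟩
    m * d′ + m * (2 * r) + m * (m * m + suc r) ≡⟨ regroup m d′ (m * m) r ⟩
    m * suc (d′ + (m * m + 3 * r))            ∎))
    where
    open ≤-Reasoning
    d = sqDist a (i , j)
    d′ = sqDist b (k , l)
    regroup : ∀ a x y z → a * x + a * (2 * z) + a * (y + (1 + z)) ≡ a * (1 + (x + (y + 3 * z)))
    regroup = solve-∀

  D≤1+m²+3r : D m n ≤ suc (m * m + 3 * r)
  D≤1+m²+3r = Unique⇒length≤1+spread (distinctSqDists m n) (m * m + 3 * r)
    (deduplicate-! (concatMap (λ a → map (sqDist a) (Qpts m n)) (Ppts m))) spread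
    where
    spread : ∀ {v w} → v ∈ distinctSqDists m n → w ∈ distinctSqDists m n → v ≤ w + (m * m + 3 * r)
    spread v∈D w∈D with _ , _ , a≤m , p∈Q , refl ← ∈-distinctSqDists⁻ {m} {n} v∈D
                       | _ , _ , b≤m , q∈Q , refl ← ∈-distinctSqDists⁻ {m} {n} w∈D
                       = sqDist-spread a≤m p∈Q b≤m q∈Q

[1,n/m+1+e]∈Q : ∀ {m n k e} .{{_ : NonZero m}} → m ≤ n → suc k * suc k ≤ m * n → e < k →
  InQ m n (1 , n / m + suc e)
[1,n/m+1+e]∈Q {m} {n} {k} {e} m≤n [1+k]²≤mn e<k =
  (≤-refl , ≤-trans (≤-reflexive (*-identityʳ m)) m≤n) , (lower , upper)
  where
  open ≤-Reasoning
  q = n / m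
  n<[1+q]m : n < suc q * m
  n<[1+q]m = begin-strict
    n             ≡⟨ m≡m%n+[m/n]*n n m ⟩
    n % m + q * m <⟨ +-monoˡ-< (q * m) (m%n<n n m) ⟩
    suc q * m     ∎
  expand : ∀ a b → suc b * a + a ≡ a * (b + suc 0 + 1)
  expand = solve-∀
  lower : n + m ≤ m * (q + suc e + 1)
  lower = begin
    n + m                 ≤⟨ +-monoˡ-≤ m (<⇒≤ n<[1+q]m) ⟩
    suc q * m + m         ≡⟨ expand m q ⟩
    m * (q + suc 0 + 1)   ≤⟨ *-monoʳ-≤ m (+-monoˡ-≤ 1 (+-monoʳ-≤ q (s≤s z≤n))) ⟩
    m * (q + suc e + 1)   ∎
  split : ∀ a b c → a * (b + suc c + 1) ≡ a * b + a * (2 + c)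
  split = solve-∀
  excess = m * (q + suc e + 1) ∸ n
  excess≤m[1+k] : excess ≤ m * suc k
  excess≤m[1+k] = begin
    excess                      ≤⟨ ∸-monoʳ-≤ (m * (q + suc e + 1)) (subst (_≤ n) (*-comm q m) (m/n*n≤m n m)) ⟩
    m * (q + suc e + 1) ∸ m * q ≡⟨ cong (_∸ m * q) (split m q e) ⟩
    m * q + m * (2 + e) ∸ m * q ≡⟨ m+n∸m≡n (m * q) (m * (2 + e)) ⟩
    m * (2 + e)                 ≤⟨ *-monoʳ-≤ m (s≤s e<k) ⟩
    m * suc k                   ∎
  square-product : ∀ a b → (a * b) * (a * b) ≡ (a * a) * (b * b)
  square-product = solve-∀
  regroup : ∀ a b → (a * a) * (a * b) ≡ a * (a * a) * b
  regroup = solve-∀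
  upper : excess ^ 2 ≤ m ^ 3 * n
  upper = begin
    excess ^ 2                ≡⟨ m^2≡m*m excess ⟩
    excess * excess           ≤⟨ *-mono-≤ excess≤m[1+k] excess≤m[1+k] ⟩
    (m * suc k) * (m * suc k) ≡⟨ square-product m (suc k) ⟩
    (m * m) * (suc k * suc k) ≤⟨ *-monoʳ-≤ (m * m) [1+k]²≤mn ⟩
    (m * m) * (m * n)         ≡⟨ regroup m n ⟩
    m * (m * m) * n           ≡⟨ cong (_* n) (m^3≡m*[m*m] m) ⟨
    m ^ 3 * n                 ∎

-- sqDist 1 (1 , j) reduces to j, so the distances below are the j themselves.
[1+k]²≤mn⇒k≤D : ∀ {m n k} .{{_ : NonZero m}} → m ≤ n → suc k * suc k ≤ m * n → k ≤ D m n
[1+k]²≤mn⇒k≤D {m} {n} {k} m≤n [1+k]²≤mn = begin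
  k                  ≡⟨ trans (length-map _ (upTo k)) (length-upTo k) ⟨
  length distances   ≤⟨ Unique-⊆⇒length≤ distances! distances⊆D ⟩
  D m n              ∎
  where
  open ≤-Reasoning
  q = n / m
  distances = map (λ e → q + suc e) (upTo k)
  distances! : Unique distances
  distances! = map⁺ (λ {e} {e′} eq → suc-injective (+-cancelˡ-≡ q (suc e) (suc e′) eq)) (upTo⁺ k)
  1≤m : 1 ≤ m
  1≤m = >-nonZero⁻¹ m
  k≤mn : k ≤ m * n
  k≤mn = ≤-trans (n≤1+n k) (≤-trans (m≤m*n (suc k) (suc k)) [1+k]²≤mn)
  distances⊆D : distances ⊆ distinctSqDists m n
  distances⊆D j∈distances with e , e∈upTo , refl ← ∈-map⁻ _ j∈distances =
    ∈-distinctSqDists⁺ ≤-refl 1≤m (≤-trans 1≤m m≤n)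
      (+-mono-≤ (m/n≤m n m) (≤-trans (∈-upTo⁻ e∈upTo) k≤mn))
      ([1,n/m+1+e]∈Q m≤n [1+k]²≤mn (∈-upTo⁻ e∈upTo))

D²≤25mn : ∀ {m n} → 2 ≤ m → m ^ 3 ≤ n → D m n ^ 2 ≤ 5 ^ 2 * (m * n)
D²≤25mn {m@(suc _)} {n} 2≤m m³≤n with r , r²≤mn , mn<[1+r]² ← ⌊√⌋ (m * n) = begin
  D m n ^ 2           ≡⟨ m^2≡m*m (D m n) ⟩
  D m n * D m n       ≤⟨ *-mono-≤ D≤5r D≤5r ⟩
  (5 * r) * (5 * r)   ≡⟨ regroup r ⟩
  25 * (r * r)        ≤⟨ *-monoʳ-≤ 25 r²≤mn ⟩
  25 * (m * n)        ∎
  where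
  open ≤-Reasoning
  regroup : ∀ a → (5 * a) * (5 * a) ≡ 25 * (a * a)
  regroup = solve-∀
  collect : ∀ a → a + a + 3 * a ≡ 5 * a
  collect = solve-∀
  m*m≤r : m * m ≤ r
  m*m≤r = m³≤n⇒m*m≤r {m} {n} m³≤n mn<[1+r]²
  1≤r : 1 ≤ r
  1≤r = ≤-trans (≤-trans (s≤s z≤n) (*-mono-≤ 2≤m 2≤m)) m*m≤r
  D≤5r : D m n ≤ 5 * r
  D≤5r = begin
    D m n               ≤⟨ D≤1+m²+3r {m} {n} {r} mn<[1+r]² ⟩
    suc (m * m + 3 * r) ≤⟨ +-monoˡ-≤ (3 * r) (+-mono-≤ 1≤r m*m≤r) ⟩
    r + r + 3 * r       ≡⟨ collect r ⟩
    5 * r               ∎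

mn≤9D² : ∀ {m n} → 2 ≤ m → m ^ 3 ≤ n → m * n ≤ 3 ^ 2 * (D m n ^ 2)
mn≤9D² {m@(suc _)} {n} 2≤m m³≤n with ⌊√⌋ (m * n)
... | zero , _ , mn<1 = contradiction (≤-trans (*-mono-≤ 2≤m 2≤m) (m³≤n⇒m*m≤r {m} {n} {0} m³≤n mn<1)) λ ()
... | suc k , [1+k]²≤mn , mn<[2+k]² = begin
  m * n                   ≤⟨ <⇒≤ mn<[2+k]² ⟩
  (2 + k) * (2 + k)       ≤⟨ *-mono-≤ 2+k≤3k 2+k≤3k ⟩
  (3 * k) * (3 * k)       ≡⟨ regroup k ⟩
  9 * (k * k)             ≤⟨ *-monoʳ-≤ 9 (*-mono-≤ k≤Dmn k≤Dmn) ⟩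
  9 * (D m n * D m n)     ≡⟨ cong (9 *_) (m^2≡m*m (D m n)) ⟨
  9 * (D m n ^ 2)         ∎
  where
  open ≤-Reasoning
  regroup : ∀ a → (3 * a) * (3 * a) ≡ 9 * (a * a)
  regroup = solve-∀
  collect : ∀ a → 2 * a + a ≡ 3 * a
  collect = solve-∀
  4≤1+k : 4 ≤ suc k
  4≤1+k = ≤-trans (*-mono-≤ 2≤m 2≤m) (m³≤n⇒m*m≤r {m} {n} m³≤n mn<[2+k]²)
  2+k≤3k : 2 + k ≤ 3 * k
  2+k≤3k = begin
    2 + k       ≤⟨ +-monoˡ-≤ k (*-monoʳ-≤ 2 (≤-trans (s≤s z≤n) (s≤s⁻¹ 4≤1+k))) ⟩
    2 * k + k   ≡⟨ collect k ⟩
    3 * k       ∎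
  m≤n : m ≤ n
  m≤n = ≤-trans (m≤m*n m (m * m)) (subst (_≤ n) (m^3≡m*[m*m] m) m³≤n)
  k≤Dmn : k ≤ D m n
  k≤Dmn = [1+k]²≤mn⇒k≤D m≤n [1+k]²≤mn

proposition2p1 : ∃₂ λ (A B : ℕ) → 1 ≤ A × 1 ≤ B ×
    (∀ (m n : ℕ) → 2 ≤ m → m ^ 3 ≤ n →
      (m * n ≤ (A ^ 2) * (D m n ^ 2)) × (D m n ^ 2 ≤ (B ^ 2) * (m * n)))
proposition2p1 = 3 , 5 , s≤s z≤n , s≤s z≤n , λ m n 2≤m m³≤n → mn≤9D² 2≤m m³≤n , D²≤25mn 2≤m m³≤n
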